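{- For the rhombus game on the triangular grid with $n$ winning sets, $\mathrm{SC}_2(\mathcal G_{\lozenge},1)\ge \frac{11n}{12}-o(n)$.
   Context: An $s$-of-$k$ game on a $k$-uniform hypergraph $(V,\mathcal F)$ (winning sets are $k$-element subsets of the finite set $V$), $1\le s\le k$: Maker and Breaker alternately claim unclaimed vertices, Maker first, until all are claimed; the score is the number of winning sets in which Maker claimed at least $s$ vertices (Maker maximizes, Breaker minimizes). A pairing strategy for Maker: she fixes in advance pairwise disjoint pairs of vertices and, whenever Breaker claims a vertex of a pair whose partner is unclaimed, she claims the partner (other moves arbitrary). $\mathrm{SC}_2(\mathcal H,s)$ is the largest score Maker can guarantee against every Breaker strategy using a pairing strategy. $\mathcal G_{\lozenge}$ is the hypergraph whose vertices are the points of a finite portion of the triangular lattice and whose winning sets are the vertex sets of all rhombi formed by two unit triangles sharing an edge, in all three orientations, so $k=4$. Grids are assumed "two-dimensional": the number of winning sets within constant distance of the boundary is $o(n)$, where $n$ is the number of winning sets; $o(n)$ refers to $n\to\infty$. -}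

module Defs where

open import Data.Bool using (Bool; true; false; not; _∧_)
open import Data.Nat as ℕ using (ℕ; zero; suc; _≤_; _≤ᵇ_; _⊔_)
open import Data.Integer as ℤ using (ℤ; +_; _-_; ∣_∣)
open import Data.Product using (_×_; _,_; ∃; Σ)
open import Data.Product.Properties using (≡-dec)
open import Data.Sum using (_⊎_)
open import Data.Unit using (⊤)
open import Data.Maybe using (Maybe; just; nothing)
open import Data.List using (List; []; _∷_; map; filter; length; cartesianProduct; upTo; concatMap)
open import Data.Bool.ListAction using (any)
import Data.List.Membership.Propositional as MemP
open import Data.List.Relation.Unary.All using (All; all?)
open import Data.List.Relation.Unary.Unique.Propositional using (Unique)
open import Relation.Binary.PropositionalEquality using (_≡_; _≢_)
open import Relation.Binary.Definitions using (DecidableEquality)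
open import Relation.Nullary using (¬_; does)
open import Relation.Nullary.Decidable using (¬?)

-- Triangular lattice in axial coordinates: the point (a , b) is
-- a·e₁ + b·e₂ with e₁, e₂ unit vectors at 60°.  The six lattice
-- neighbours of p are p ± (1,0), p ± (0,1), p ± (1,-1).

Pt : Set
Pt = ℤ × ℤ

_≟P_ : DecidableEquality Pt
_≟P_ = ≡-dec ℤ._≟_ ℤ._≟_

open import Data.List.Membership.DecPropositional _≟P_ public
  using (_∈_; _∉_; _∈?_)

_⊕_ : Pt → Pt → Pt
(a , b) ⊕ (c , d) = (a ℤ.+ c , b ℤ.+ d)

-- graph distance in the triangular lattice
dist : Pt → Pt → ℕ
dist (a , b) (c , d) = ∣ x ∣ ⊔ ∣ y ∣ ⊔ ∣ x ℤ.+ y ∣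
  where
  x = a - c
  y = b - d

-- Rhombi (two unit triangles sharing an edge), three orientations.
-- Each rhombus is given once by its orientation and anchor point p.

data Orient : Set where
  o₁ o₂ o₃ : Orient

orients : List Orient
orients = o₁ ∷ o₂ ∷ o₃ ∷ []

-- sides e₁ and e₂           : triangles p,p+e₁,p+e₂ and p+e₁,p+e₂,p+e₁+e₂
-- sides (1,-1) and (0,1)    : triangles p,p+e₁,p+e₂ and p,p+e₁,p+(1,-1)
-- sides e₁ and (-1,1)       : triangles p,p+e₁,p+e₂ and p,p+e₂,p+(-1,1)
rhombus : Orient → Pt → List Pt
rhombus o₁ p = p ∷ p ⊕ (+ 1 , + 0) ∷ p ⊕ (+ 0 , + 1) ∷ p ⊕ (+ 1 , + 1) ∷ []
rhombus o₂ p = p ∷ p ⊕ (+ 1 , + 0) ∷ p ⊕ (+ 0 , + 1) ∷ p ⊕ (+ 1 , ℤ.- + 1) ∷ []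
rhombus o₃ p = p ∷ p ⊕ (+ 1 , + 0) ∷ p ⊕ (+ 0 , + 1) ∷ p ⊕ (ℤ.- + 1 , + 1) ∷ []

record Grid : Set where
  field
    pts  : List Pt
    uniq : Unique pts
open Grid public

winningSets : List Pt → List (List Pt)
winningSets V =
  map (λ (o , p) → rhombus o p)
      (filter (λ (o , p) → all? (_∈? V) (rhombus o p))
              (cartesianProduct orients V))

nWin : Grid → ℕ
nWin G = length (winningSets (pts G))

claimedIn : List Pt → List Pt → ℕ
claimedIn M W = length (filter (_∈? M) W)

score : List Pt → ℕ → List Pt → ℕ
score V s M = length (filter (λ W → s ℕ.≤? claimedIn M W) (winningSets V))

-- Winning sets within distance c of the boundary: some vertex w of the
-- rhombus has a lattice point q ∉ V with dist q w ≤ c.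
-- (Decided by enumerating offsets in the box [-c,c]².)

range : ℕ → List ℤ
range c = map (λ i → + i - + c) (upTo (suc (c ℕ.+ c)))

nearB : ℕ → List Pt → List Pt → Bool
nearB c V W =
  any (λ w → any (λ off → (dist (w ⊕ off) w ≤ᵇ c) ∧ not (does (w ⊕ off ∈? V)))
                 (cartesianProduct (range c) (range c)))
      W

nearCount : ℕ → Grid → ℕ
nearCount c G = length (Data.List.filterᵇ (nearB c (pts G)) (winningSets (pts G)))

IsPairing : List Pt → List (Pt × Pt) → Set
IsPairing V P =
  All (λ (x , y) → x ∈ V × y ∈ V × x ≢ y) P
  × Unique (concatMap (λ (x , y) → x ∷ y ∷ []) P)

Partner : List (Pt × Pt) → Pt → Pt → Set
Partner P b y = (b , y) MemP.∈ P ⊎ (y , b) MemP.∈ P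

Unclaimed : List Pt → List Pt → Pt → Set
Unclaimed M B v = v ∉ M × v ∉ B

AllClaimed : List Pt → List Pt → List Pt → Set
AllClaimed V M B = All (λ v → v ∈ M ⊎ v ∈ B) V

Forced : List (Pt × Pt) → List Pt → List Pt → Maybe Pt → Pt → Set
Forced P M B nothing  v = ⊤
Forced P M B (just b) v = ∀ y → Partner P b y → Unclaimed M B y → v ≡ y

-- MakerTurn V s t P last M B : in the position where Maker has claimed M,
-- Breaker has claimed B, Breaker's last move was `last`, and Maker is to
-- move, Maker (obeying pairing P) can ensure the final s-score is ≥ t
-- against every Breaker strategy.  BreakerTurn likewise with Breaker to move.
data MakerTurn   (V : List Pt) (s t : ℕ) (P : List (Pt × Pt)) :
                 Maybe Pt → List Pt → List Pt → Set
data BreakerTurn (V : List Pt) (s t : ℕ) (P : List (Pt × Pt)) :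
                 List Pt → List Pt → Set

data MakerTurn V s t P where
  mEnd  : ∀ {last M B} → AllClaimed V M B → t ≤ score V s M →
          MakerTurn V s t P last M B
  mMove : ∀ {last M B} (v : Pt) → v ∈ V → Unclaimed M B v →
          Forced P M B last v → BreakerTurn V s t P (v ∷ M) B →
          MakerTurn V s t P last M B

data BreakerTurn V s t P where
  bEnd  : ∀ {M B} → AllClaimed V M B → t ≤ score V s M →
          BreakerTurn V s t P M B
  bMove : ∀ {M B} → (∃ λ v → v ∈ V × Unclaimed M B v) →
          (∀ b → b ∈ V → Unclaimed M B b → MakerTurn V s t P (just b) M (b ∷ B)) →
          BreakerTurn V s t P M B

-- Maker can guarantee score ≥ t with a pairing strategy, i.e. SC₂(H,s) ≥ t
PairingGuarantees : List Pt → ℕ → ℕ → Set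
PairingGuarantees V s t =
  Σ (List (Pt × Pt)) λ P → IsPairing V P × MakerTurn V s t P nothing [] []

{-# OPTIONS --safe #-}
module Submission where

-- Colour the lattice point (a , b) by a + 2b mod 4 and let Maker pair every point of colour 3 with its
-- neighbour p + (1,0) (colour 0) and every point of colour 1 with p + (-1,1) (colour 2).  Playing this
-- pairing she ends with a vertex of every pair inside the grid.  Every rhombus contains a pair except the
-- rhombi of orientation o₁ at colour-2 points k and of orientation o₂ at k + (-1,2), and for each such k
-- the mate of k + (1,1) lies in the second one, so at most one rhombus per colour-2 point k is lost.
-- The twelve rhombi of the three orientations anchored at k, k + (1,0), k + (0,1), k + (-1,2) have
-- anchors of four different colours, so these blocks are disjoint: at most n/12 of them lie inside the
-- grid, and a lost rhombus whose block sticks out of the grid lies within distance 4 of the boundary.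

open import Data.Bool using (Bool; true; false; not; T; _∧_)
import Data.Bool.Properties as Bool
open import Data.Bool.ListAction using (any)
open import Data.Empty using (⊥; ⊥-elim)
open import Data.Fin as Fin using (Fin; toℕ)
import Data.Fin.Properties as Fin
open import Data.Fin.Patterns using (0F; 1F; 2F; 3F)
open import Data.Integer as ℤ using (ℤ; +_; -[1+_]; _⊖_; ∣_∣)
import Data.Integer.Properties as ℤ
open import Algebra.Properties.AbelianGroup ℤ.+-0-abelianGroup using (∙-cancelʳ)
import Data.Integer.Tactic.RingSolver as ℤ-Solver
open import Data.List as List
  using (List; []; _∷_; _++_; map; filter; filterᵇ; length; concatMap; cartesianProduct)
import Data.List.Properties as List
open import Data.List.Relation.Unary.All as All using (All; []; _∷_; all?)
import Data.List.Relation.Unary.All.Properties as Allₚ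
open import Data.List.Relation.Unary.AllPairs using ([]; _∷_)
open import Data.List.Relation.Unary.Any as Any using (Any; here; there; any?)
import Data.List.Relation.Unary.Any.Properties as Anyₚ
open import Data.List.Relation.Unary.Unique.Propositional using (Unique)
import Data.List.Relation.Unary.Unique.Propositional.Properties as Unique
import Data.List.Membership.Propositional as Mem
open import Data.List.Membership.Propositional.Properties
  using (∈-map⁺; ∈-map⁻; ∈-filter⁺; ∈-filter⁻; ∈-∃++; ∈-++⁻; ∈-++⁺ˡ; ∈-++⁺ʳ;
         ∈-cartesianProduct⁺; ∈-cartesianProduct⁻; ∈-concatMap⁺)
open import Data.Maybe using (just; nothing)
open import Data.Nat as ℕ using (ℕ; zero; suc; _+_; _*_; _∸_; _≤_; _<_; _≤ᵇ_; _⊔_; z≤n; s≤s)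
import Data.Nat.Properties as ℕ
open import Data.Nat.DivMod using (_%_; _mod_; [m+n]%n≡m%n; %-distribˡ-+)
open import Data.Nat.Tactic.RingSolver using (solve-∀)
open import Data.Product using (_×_; _,_; ∃; proj₁; proj₂)
open import Data.Sum as Sum using (_⊎_; inj₁; inj₂; [_,_]′)
open import Data.Unit using (tt)
open import Function.Base using (id; _∘_)
open import Function.Bundles using (Equivalence)
open import Relation.Binary.PropositionalEquality
open import Relation.Nullary using (¬_; Dec; yes; no; does; contradiction)
open import Relation.Nullary.Decidable using (¬?; _×-dec_; _⊎-dec_; map′; from-yes; dec-false)
open import Relation.Unary using (Decidable)
open import Relation.Unary.Properties using (_∪?_)

open import Defs

module _ {A : Set} {P Q : A → Set} (P? : Decidable P) (Q? : Decidable Q) where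

  length-filter-∪ : ∀ xs → length (filter (P? ∪? Q?) xs) ≤ length (filter P? xs) + length (filter Q? xs)
  length-filter-∪ []       = z≤n
  length-filter-∪ (x ∷ xs) with ih ← length-filter-∪ xs | P? x | Q? x
  ... | yes _ | yes _ = s≤s (ℕ.≤-trans ih (ℕ.+-monoʳ-≤ (length (filter P? xs)) (ℕ.n≤1+n _)))
  ... | yes _ | no  _ = s≤s ih
  ... | no  _ | yes _ = ℕ.≤-trans (s≤s ih) (ℕ.≤-reflexive (sym (ℕ.+-suc _ _)))
  ... | no  _ | no  _ = ih

  module _ (Q⇒P : ∀ {x} → Q x → P x) where

    length-filter-mono : ∀ xs → length (filter Q? xs) ≤ length (filter P? xs)
    length-filter-mono []       = z≤n
    length-filter-mono (x ∷ xs) with ih ← length-filter-mono xs | P? x | Q? x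
    ... | yes _ | yes _ = s≤s ih
    ... | yes _ | no  _ = ℕ.m≤n⇒m≤1+n ih
    ... | no ¬p | yes q = contradiction (Q⇒P q) ¬p
    ... | no  _ | no  _ = ih

    length-filter-< : ∀ {xs} → Any (λ x → P x × ¬ Q x) xs → length (filter Q? xs) < length (filter P? xs)
    length-filter-< {x ∷ xs} (here (px , ¬qx)) with P? x | Q? x
    ... | yes _ | no  _  = s≤s (length-filter-mono xs)
    ... | no ¬p | _      = contradiction px ¬p
    ... | yes _ | yes qx = contradiction qx ¬qx
    length-filter-< {x ∷ xs} (there any) with ih ← length-filter-< any | P? x | Q? x
    ... | yes _ | yes _ = s≤s ih
    ... | yes _ | no  _ = ℕ.m≤n⇒m≤1+n ih
    ... | no ¬p | yes q = contradiction (Q⇒P q) ¬p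
    ... | no  _ | no  _ = ih

module _ {A B : Set} (f : A → B) where

  length-≤-injection : ∀ {xs ys} → Unique xs → (∀ {x} → x Mem.∈ xs → f x Mem.∈ ys) →
                       (∀ {x y} → x Mem.∈ xs → y Mem.∈ xs → f x ≡ f y → x ≡ y) →
                       length xs ≤ length ys
  length-≤-injection {[]}     _            _    _   = z≤n
  length-≤-injection {x ∷ xs} (x∉xs ∷ uxs) into inj with ∈-∃++ (into (here refl))
  ... | us , vs , refl = begin
    suc (length xs)                 ≤⟨ s≤s (length-≤-injection uxs into′ λ a b → inj (there a) (there b)) ⟩
    suc (length (us ++ vs))         ≡⟨ cong suc (List.length-++ us) ⟩
    suc (length us + length vs)     ≡⟨ ℕ.+-suc (length us) (length vs) ⟨
    length us + length (f x ∷ vs)   ≡⟨ List.length-++ us ⟨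
    length (us ++ f x ∷ vs)         ∎
    where
    open ℕ.≤-Reasoning
    into′ : ∀ {y} → y Mem.∈ xs → f y Mem.∈ us ++ vs
    into′ y∈xs with ∈-++⁻ us (into (there y∈xs))
    ... | inj₁ fy∈us         = ∈-++⁺ˡ fy∈us
    ... | inj₂ (here fy≡fx)  = ⊥-elim (All.lookup x∉xs y∈xs (inj (here refl) (there y∈xs) (sym fy≡fx)))
    ... | inj₂ (there fy∈vs) = ∈-++⁺ʳ us fy∈vs

  length-filter-map : ∀ {P : B → Set} (P? : Decidable P) xs →
                      length (filter P? (map f xs)) ≡ length (filter (P? ∘ f) xs)
  length-filter-map P? []       = refl
  length-filter-map P? (x ∷ xs) with P? (f x)
  ... | yes _ = cong suc (length-filter-map P? xs)
  ... | no  _ = length-filter-map P? xs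

length-cartesianProduct : ∀ {A B : Set} (xs : List A) (ys : List B) →
                          length (cartesianProduct xs ys) ≡ length xs * length ys
length-cartesianProduct []       ys = refl
length-cartesianProduct (x ∷ xs) ys = begin
  length (map (x ,_) ys ++ cartesianProduct xs ys)         ≡⟨ List.length-++ (map (x ,_) ys) ⟩
  length (map (x ,_) ys) + length (cartesianProduct xs ys) ≡⟨ cong₂ _+_ (List.length-map (x ,_) ys)
                                                                        (length-cartesianProduct xs ys) ⟩
  length ys + length xs * length ys                        ∎
  where open ≡-Reasoning

-- Pairing strategies

endpoints : List (Pt × Pt) → List Pt
endpoints = concatMap (λ (x , y) → x ∷ y ∷ [])

module _ {P : List (Pt × Pt)} where

  partner-sym : ∀ {b y} → Partner P b y → Partner P y b
  partner-sym (inj₁ m) = inj₂ m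
  partner-sym (inj₂ m) = inj₁ m

  partner-∈ : ∀ {V b y} → IsPairing V P → Partner P b y → y ∈ V
  partner-∈ (inV , _) (inj₁ m) = proj₁ (proj₂ (All.lookup inV m))
  partner-∈ (inV , _) (inj₂ m) = proj₁ (All.lookup inV m)

  partner-irrefl : ∀ {V b} → IsPairing V P → ¬ Partner P b b
  partner-irrefl (inV , _) (inj₁ m) = proj₂ (proj₂ (All.lookup inV m)) refl
  partner-irrefl (inV , _) (inj₂ m) = proj₂ (proj₂ (All.lookup inV m)) refl

partner-endpoint : ∀ {P b y} → Partner P b y → b ∈ endpoints P
partner-endpoint         (inj₁ (here refl)) = here refl
partner-endpoint         (inj₂ (here refl)) = there (here refl)
partner-endpoint {_ ∷ _} (inj₁ (there m))   = there (there (partner-endpoint (inj₁ m)))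
partner-endpoint {_ ∷ _} (inj₂ (there m))   = there (there (partner-endpoint (inj₂ m)))

partner-∷ : ∀ {x z P b y} → Partner ((x , z) ∷ P) b y →
            (b ≡ x × y ≡ z) ⊎ (b ≡ z × y ≡ x) ⊎ Partner P b y
partner-∷ (inj₁ (here refl)) = inj₁ (refl , refl)
partner-∷ (inj₂ (here refl)) = inj₂ (inj₁ (refl , refl))
partner-∷ (inj₁ (there m))   = inj₂ (inj₂ (inj₁ m))
partner-∷ (inj₂ (there m))   = inj₂ (inj₂ (inj₂ m))

partner-unique : ∀ {P b y y′} → Unique (endpoints P) → Partner P b y → Partner P b y′ → y ≡ y′
partner-unique {[]} _ (inj₁ ()) _
partner-unique {[]} _ (inj₂ ()) _
partner-unique {(x , z) ∷ P} (x∉ ∷ z∉ ∷ u) p p′ with partner-∷ p | partner-∷ p′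
... | inj₁ (refl , refl)        | inj₁ (refl , refl)        = refl
... | inj₂ (inj₁ (refl , refl)) | inj₂ (inj₁ (refl , refl)) = refl
... | inj₂ (inj₂ q)             | inj₂ (inj₂ q′)            = partner-unique u q q′
... | inj₁ (refl , _)           | inj₂ (inj₁ (x≡z , _))     = ⊥-elim (All.head x∉ x≡z)
... | inj₂ (inj₁ (refl , _))    | inj₁ (z≡x , _)            = ⊥-elim (All.head x∉ (sym z≡x))
... | inj₁ (refl , _)        | inj₂ (inj₂ q′)         = ⊥-elim (All.lookup x∉ (there (partner-endpoint q′)) refl)
... | inj₂ (inj₂ q)          | inj₁ (refl , _)        = ⊥-elim (All.lookup x∉ (there (partner-endpoint q)) refl)
... | inj₂ (inj₁ (refl , _)) | inj₂ (inj₂ q′)         = ⊥-elim (All.lookup z∉ (partner-endpoint q′) refl)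
... | inj₂ (inj₂ q)          | inj₂ (inj₁ (refl , _)) = ⊥-elim (All.lookup z∉ (partner-endpoint q) refl)

Meets : List (Pt × Pt) → List Pt → Set
Meets P M = All (λ (x , y) → x ∈ M ⊎ y ∈ M) P

unclaimed? : ∀ M B → Decidable (Unclaimed M B)
unclaimed? M B v = ¬? (v ∈? M) ×-dec ¬? (v ∈? B)

claimed? : ∀ M B → Decidable (λ v → v ∈ M ⊎ v ∈ B)
claimed? M B v = (v ∈? M) ⊎-dec (v ∈? B)

someUnclaimed : ∀ {V M B} → ¬ AllClaimed V M B → ∃ λ v → v ∈ V × Unclaimed M B v
someUnclaimed {V} {M} {B} ¬done with Mem.find (Allₚ.¬All⇒Any¬ (claimed? M B) V ¬done)
... | v , v∈V , ¬claimed = v , v∈V , (λ m → ¬claimed (inj₁ m)) , (λ m → ¬claimed (inj₂ m))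

module PairingStrategy {V : List Pt} {P : List (Pt × Pt)} (pairing : IsPairing V P)
                       {s t : ℕ} (enough : ∀ M → Meets P M → t ≤ score V s M) where

  Answered : List Pt → List Pt → Set
  Answered M B = ∀ {b y} → Partner P b y → b ∈ B → y ∈ M

  FreePartner : List Pt → List Pt → Pt → Set
  FreePartner M B b = ∃ λ y → Partner P b y × Unclaimed M B y

  freePartner? : ∀ M B b → Dec (FreePartner M B b)
  freePartner? M B b = map′ found lost (any? free? P)
    where
    Free : Pt × Pt → Set
    Free (x , z) = (x ≡ b × Unclaimed M B z) ⊎ (z ≡ b × Unclaimed M B x)
    free? : Decidable Free
    free? (x , z) = ((x ≟P b) ×-dec unclaimed? M B z) ⊎-dec ((z ≟P b) ×-dec unclaimed? M B x)
    found : Any Free P → FreePartner M B b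
    found a with Mem.find a
    ... | (x , z) , m , inj₁ (refl , z-free) = z , inj₁ m , z-free
    ... | (x , z) , m , inj₂ (refl , x-free) = x , inj₂ m , x-free
    lost : FreePartner M B b → Any Free P
    lost (y , inj₁ m , y-free) = Mem.lose m (inj₁ (refl , y-free))
    lost (y , inj₂ m , y-free) = Mem.lose m (inj₂ (refl , y-free))

  meets : ∀ {M B} → AllClaimed V M B → Answered M B → Meets P M
  meets {M} {B} done answered = All.tabulate meet
    where
    meet : ∀ {xy} → xy Mem.∈ P → proj₁ xy ∈ M ⊎ proj₂ xy ∈ M
    meet m with All.lookup done (proj₁ (All.lookup (proj₁ pairing) m))
    ... | inj₁ x∈M = inj₁ x∈M
    ... | inj₂ x∈B = inj₂ (answered (inj₁ m) x∈B)

  #unclaimed : List Pt → List Pt → ℕ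
  #unclaimed M B = length (filter (unclaimed? M B) V)

  claiming-shrinks : ∀ {M B v b} → b ∈ V → Unclaimed M B b → #unclaimed (v ∷ M) (b ∷ B) < #unclaimed M B
  claiming-shrinks {M} {B} {v} {b} b∈V b-free =
    length-filter-< (unclaimed? M B) (unclaimed? (v ∷ M) (b ∷ B))
      (λ (∉vM , ∉bB) → (λ m → ∉vM (there m)) , (λ m → ∉bB (there m)))
      (Any.map (λ { refl → b-free , λ (_ , ∉bB) → ∉bB (here refl) }) b∈V)

  claimed-partner : ∀ {M B b y} → Answered M B → b ∉ M → Partner P b y → y ∈ M ⊎ y ∈ b ∷ B → y ∈ M
  claimed-partner _        _   _ (inj₁ y∈M)         = y∈M
  claimed-partner _        _   p (inj₂ (here refl)) = ⊥-elim (partner-irrefl pairing p)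
  claimed-partner answered b∉M p (inj₂ (there y∈B)) = ⊥-elim (b∉M (answered (partner-sym p) y∈B))

  answered-∷ : ∀ {M M′ B b} → Answered M B → (∀ {x} → x ∈ M → x ∈ M′) →
               (∀ {y} → Partner P b y → y ∈ M′) → Answered M′ (b ∷ B)
  answered-∷ _        _     partnered p (here refl)  = partnered p
  answered-∷ answered M⊆M′ _         p (there b∈B) = M⊆M′ (answered p b∈B)

  breakerTurn : ∀ n {M B} → #unclaimed M B < n → Answered M B → BreakerTurn V s t P M B
  makerTurn   : ∀ n {M B b} → b ∈ V → Unclaimed M B b → #unclaimed M B ≤ n → Answered M B →
                MakerTurn V s t P (just b) M (b ∷ B)

  breakerTurn (suc n) {M} {B} fuel answered with all? (claimed? M B) V
  ... | yes done = bEnd done (enough M (meets done answered))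
  ... | no ¬done = bMove (someUnclaimed ¬done) λ _ b∈V b-free →
                     makerTurn n b∈V b-free (ℕ.≤-pred fuel) answered

  makerTurn n {M} {B} {b} b∈V b-free@(b∉M , _) fuel answered with all? (claimed? M (b ∷ B)) V
  ... | yes done = mEnd done (enough M (meets done (answered-∷ answered id partnered)))
    where
    partnered : ∀ {y} → Partner P b y → y ∈ M
    partnered p = claimed-partner answered b∉M p (All.lookup done (partner-∈ pairing p))
  ... | no ¬done with freePartner? M (b ∷ B) b
  ...   | yes (y , p , y-free) =
            mMove y (partner-∈ pairing p) y-free (λ _ p′ _ → partner-unique (proj₂ pairing) p p′)
              (breakerTurn n (ℕ.<-≤-trans (claiming-shrinks b∈V b-free) fuel)
                 (answered-∷ answered there λ p′ → here (partner-unique (proj₂ pairing) p′ p)))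
  ...   | no none with someUnclaimed ¬done
  ...     | v , v∈V , v-free =
            mMove v v∈V v-free (λ y p y-free → ⊥-elim (none (y , p , y-free)))
              (breakerTurn n (ℕ.<-≤-trans (claiming-shrinks b∈V b-free) fuel)
                 (answered-∷ answered there λ p → there (claimed-partner answered b∉M p (claimed p))))
    where
    claimed : ∀ {y} → Partner P b y → y ∈ M ⊎ y ∈ b ∷ B
    claimed {y} p with claimed? M (b ∷ B) y
    ... | yes c = c
    ... | no ¬c = ⊥-elim (none (y , p , (λ m → ¬c (inj₁ m)) , (λ m → ¬c (inj₂ m))))

  pairingStrategy : MakerTurn V s t P nothing [] []
  pairingStrategy with all? (claimed? [] []) V
  ... | yes done = mEnd done (enough [] (meets done λ _ ()))
  ... | no ¬done with someUnclaimed ¬done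
  ...   | v , v∈V , v-free = mMove v v∈V v-free tt
            (breakerTurn (suc (length V)) (s≤s (List.length-filter (unclaimed? (v ∷ []) []) V)) λ _ ())

-- Lattice points and their colour in ℤ/4

ℤ₄ : Set
ℤ₄ = Fin 4

infixl 6 _+₄_
_+₄_ : ℤ₄ → ℤ₄ → ℤ₄
i +₄ j = (toℕ i + toℕ j) mod 4

-- a natural number congruent to x modulo 4
rep : ℤ → ℕ
rep (+ n)    = n
rep -[1+ n ] = 3 * suc n

rep-⊖ : ∀ m n → rep (m ⊖ n) % 4 ≡ (m + 3 * n) % 4
rep-⊖ m       zero    = cong (_% 4) (sym (ℕ.+-identityʳ m))
rep-⊖ zero    (suc n) = refl
rep-⊖ (suc m) (suc n) = begin
  rep (suc m ⊖ suc n) % 4  ≡⟨ cong (λ z → rep z % 4) (ℤ.[1+m]⊖[1+n]≡m⊖n m n) ⟩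
  rep (m ⊖ n) % 4          ≡⟨ rep-⊖ m n ⟩
  (m + 3 * n) % 4          ≡⟨ [m+n]%n≡m%n (m + 3 * n) 4 ⟨
  (m + 3 * n + 4) % 4      ≡⟨ cong (_% 4) (shift m n) ⟩
  (suc m + 3 * suc n) % 4  ∎
  where
  open ≡-Reasoning
  shift : ∀ m n → m + 3 * n + 4 ≡ suc m + 3 * suc n
  shift = solve-∀

rep-+ : ∀ x y → rep (x ℤ.+ y) % 4 ≡ (rep x + rep y) % 4
rep-+ (+ m)    (+ n)    = refl
rep-+ (+ m)    -[1+ n ] = rep-⊖ m (suc n)
rep-+ -[1+ m ] (+ n)    = trans (rep-⊖ n (suc m)) (cong (_% 4) (ℕ.+-comm n (3 * suc m)))
rep-+ -[1+ m ] -[1+ n ] = cong (_% 4) (twice m n)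
  where
  twice : ∀ m n → 3 * suc (suc (m + n)) ≡ 3 * suc m + 3 * suc n
  twice = solve-∀

⟦_⟧₄ : ℤ → ℤ₄
⟦ x ⟧₄ = rep x mod 4

toℕ-mod : ∀ m → toℕ (m mod 4) ≡ m % 4
toℕ-mod m = Fin.toℕ-fromℕ< _

⟦⟧₄-homo-+ : ∀ x y → ⟦ x ℤ.+ y ⟧₄ ≡ ⟦ x ⟧₄ +₄ ⟦ y ⟧₄
⟦⟧₄-homo-+ x y = Fin.toℕ-injective (begin
  toℕ ⟦ x ℤ.+ y ⟧₄               ≡⟨ toℕ-mod (rep (x ℤ.+ y)) ⟩
  rep (x ℤ.+ y) % 4              ≡⟨ rep-+ x y ⟩
  (rep x + rep y) % 4            ≡⟨ %-distribˡ-+ (rep x) (rep y) 4 ⟩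
  (rep x % 4 + rep y % 4) % 4    ≡⟨ cong₂ (λ a b → (a + b) % 4) (toℕ-mod (rep x)) (toℕ-mod (rep y)) ⟨
  (toℕ ⟦ x ⟧₄ + toℕ ⟦ y ⟧₄) % 4  ≡⟨ toℕ-mod (toℕ ⟦ x ⟧₄ + toℕ ⟦ y ⟧₄) ⟨
  toℕ (⟦ x ⟧₄ +₄ ⟦ y ⟧₄)         ∎)
  where open ≡-Reasoning

origin : Pt
origin = + 0 , + 0

⊕-assoc : ∀ p q r → (p ⊕ q) ⊕ r ≡ p ⊕ (q ⊕ r)
⊕-assoc (a , b) (c , d) (e , f) = cong₂ _,_ (ℤ.+-assoc a c e) (ℤ.+-assoc b d f)

⊕-identityʳ : ∀ p → p ⊕ origin ≡ p
⊕-identityʳ (a , b) = cong₂ _,_ (ℤ.+-identityʳ a) (ℤ.+-identityʳ b)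

⊕-cancelʳ : ∀ d {p q} → p ⊕ d ≡ q ⊕ d → p ≡ q
⊕-cancelʳ (c , d) {a , b} {a′ , b′} e =
  cong₂ _,_ (∙-cancelʳ c a a′ (cong proj₁ e)) (∙-cancelʳ d b b′ (cong proj₂ e))

colour : Pt → ℤ₄
colour (a , b) = ⟦ a ℤ.+ + 2 ℤ.* b ⟧₄

colour-homo-⊕ : ∀ p q → colour (p ⊕ q) ≡ colour p +₄ colour q
colour-homo-⊕ (a , b) (c , d) =
  trans (cong ⟦_⟧₄ (regroup a b c d)) (⟦⟧₄-homo-+ (a ℤ.+ + 2 ℤ.* b) (c ℤ.+ + 2 ℤ.* d))
  where
  regroup : ∀ a b c d → (a ℤ.+ c) ℤ.+ + 2 ℤ.* (b ℤ.+ d) ≡ (a ℤ.+ + 2 ℤ.* b) ℤ.+ (c ℤ.+ + 2 ℤ.* d)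
  regroup = ℤ-Solver.solve-∀

mateStep : ℤ₄ → Pt
mateStep 0F = -[1+ 0 ] , + 0
mateStep 1F = -[1+ 0 ] , + 1
mateStep 2F = + 1 , -[1+ 0 ]
mateStep 3F = + 1 , + 0

mate : Pt → Pt
mate p = p ⊕ mateStep (colour p)

mateOffset : ℤ₄ → Pt → Pt
mateOffset c u = u ⊕ mateStep (c +₄ colour u)

mate-⊕ : ∀ p u → mate (p ⊕ u) ≡ p ⊕ mateOffset (colour p) u
mate-⊕ p u = trans (cong (λ c → (p ⊕ u) ⊕ mateStep c) (colour-homo-⊕ p u)) (⊕-assoc p u _)

mate-involutive : ∀ p → mate (mate p) ≡ p
mate-involutive p = begin
  mate (p ⊕ mateStep (colour p))                  ≡⟨ mate-⊕ p (mateStep (colour p)) ⟩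
  p ⊕ mateOffset (colour p) (mateStep (colour p)) ≡⟨ cong (p ⊕_) (step-back (colour p)) ⟩
  p ⊕ origin                                      ≡⟨ ⊕-identityʳ p ⟩
  p                                               ∎
  where
  open ≡-Reasoning
  step-back : ∀ c → mateOffset c (mateStep c) ≡ origin
  step-back 0F = refl
  step-back 1F = refl
  step-back 2F = refl
  step-back 3F = refl

isLow : ℤ₄ → Bool
isLow 0F = true
isLow 1F = true
isLow 2F = false
isLow 3F = false

isLow-mate : ∀ p → isLow (colour (mate p)) ≡ not (isLow (colour p))
isLow-mate p = trans (cong isLow (colour-homo-⊕ p (mateStep (colour p)))) (flips (colour p))
  where
  flips : ∀ c → isLow (c +₄ colour (mateStep c)) ≡ not (isLow c)
  flips 0F = refl
  flips 1F = refl
  flips 2F = refl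
  flips 3F = refl

Low : Pt → Set
Low p = isLow (colour p) ≡ true

low-mate : ∀ p → Low p → ¬ Low (mate p)
low-mate p low low′ = contradiction (trans (sym low′) (trans (isLow-mate p) (cong not low))) λ ()

high-mate : ∀ p → ¬ Low p → Low (mate p)
high-mate p high = trans (isLow-mate p) (cong not (Bool.¬-not high))

mate-≢ : ∀ p → mate p ≢ p
mate-≢ p e = Bool.not-¬ refl (trans (sym (cong (isLow ∘ colour) e)) (isLow-mate p))

matePair : Pt → Pt × Pt
matePair r = r , mate r

LowMated : List Pt → Pt → Set
LowMated V r = Low r × mate r ∈ V

lowMated? : ∀ V → Decidable (LowMated V)
lowMated? V r = (isLow (colour r) Bool.≟ true) ×-dec (mate r ∈? V)

matePairs : List Pt → List (Pt × Pt)
matePairs V = map matePair (filter (lowMated? V) V)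

∈-endpoints : ∀ R {x} → x ∈ endpoints (map matePair R) → ∃ λ r → r ∈ R × (x ≡ r ⊎ x ≡ mate r)
∈-endpoints (r ∷ R) (here refl)         = r , here refl , inj₁ refl
∈-endpoints (r ∷ R) (there (here refl)) = r , here refl , inj₂ refl
∈-endpoints (r ∷ R) (there (there m)) with ∈-endpoints R m
... | r′ , r′∈R , e = r′ , there r′∈R , e

endpoints-unique : ∀ {R} → Unique R → All Low R → Unique (endpoints (map matePair R))
endpoints-unique {[]}    []          []           = []
endpoints-unique {r ∷ R} (r∉R ∷ uR) (low ∷ lows) =
  ((λ e → mate-≢ r (sym e)) ∷ All.tabulate r-fresh) ∷ All.tabulate mate-fresh ∷ endpoints-unique uR lows
  where
  r-fresh : ∀ {x} → x ∈ endpoints (map matePair R) → r ≢ x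
  r-fresh m refl with ∈-endpoints R m
  ... | r′ , r′∈R , inj₁ refl = All.lookup r∉R r′∈R refl
  ... | r′ , r′∈R , inj₂ refl = low-mate r′ (All.lookup lows r′∈R) low
  mate-fresh : ∀ {x} → x ∈ endpoints (map matePair R) → mate r ≢ x
  mate-fresh m refl with ∈-endpoints R m
  ... | r′ , r′∈R , inj₁ e = low-mate r low (subst Low (sym e) (All.lookup lows r′∈R))
  ... | r′ , r′∈R , inj₂ e = All.lookup r∉R r′∈R
                               (trans (sym (mate-involutive r)) (trans (cong mate e) (mate-involutive r′)))

matePairs-isPairing : ∀ {V} → Unique V → IsPairing V (matePairs V)
matePairs-isPairing {V} uV = All.tabulate pair-ok , endpoints-unique (Unique.filter⁺ (lowMated? V) uV) lows
  where
  pair-ok : ∀ {xy} → xy Mem.∈ matePairs V → proj₁ xy ∈ V × proj₂ xy ∈ V × proj₁ xy ≢ proj₂ xy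
  pair-ok m with ∈-map⁻ matePair m
  ... | r , r∈ , refl with ∈-filter⁻ (lowMated? V) {xs = V} r∈
  ... | r∈V , _ , mate∈V = r∈V , mate∈V , λ e → mate-≢ r (sym e)
  lows : All Low (filter (lowMated? V) V)
  lows = All.tabulate λ m → proj₁ (proj₂ (∈-filter⁻ (lowMated? V) {xs = V} m))

MeetsMates : List Pt → List Pt → Set
MeetsMates V M = ∀ {x} → x ∈ V → mate x ∈ V → x ∈ M ⊎ mate x ∈ M

meets-mates : ∀ {V M} → Meets (matePairs V) M → MeetsMates V M
meets-mates {V} meets {x} x∈V mate∈V with isLow (colour x) Bool.≟ true
... | yes low  = All.lookup meets (∈-map⁺ matePair (∈-filter⁺ (lowMated? V) x∈V (low , mate∈V)))
... | no  high = Sum.swap (Sum.map₂ (subst (_∈ _) (mate-involutive x))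
                   (All.lookup meets (∈-map⁺ matePair (∈-filter⁺ (lowMated? V) mate∈V
                      (high-mate x high , subst (_∈ V) (sym (mate-involutive x)) x∈V)))))

-- Rhombi and mates

⊕-assoc₄ : ∀ p q a b c → (p ⊕ q) ∷ (p ⊕ q) ⊕ a ∷ (p ⊕ q) ⊕ b ∷ (p ⊕ q) ⊕ c ∷ []
                         ≡ map (p ⊕_) (q ∷ q ⊕ a ∷ q ⊕ b ∷ q ⊕ c ∷ [])
⊕-assoc₄ p q a b c =
  cong (p ⊕ q ∷_) (cong₂ _∷_ (⊕-assoc p q a) (cong₂ _∷_ (⊕-assoc p q b) (cong (_∷ []) (⊕-assoc p q c))))

rhombus-⊕ : ∀ o p q → rhombus o (p ⊕ q) ≡ map (p ⊕_) (rhombus o q)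
rhombus-⊕ o₁ p q = ⊕-assoc₄ p q _ _ _
rhombus-⊕ o₂ p q = ⊕-assoc₄ p q _ _ _
rhombus-⊕ o₃ p q = ⊕-assoc₄ p q _ _ _

rhombus-at : ∀ o p → rhombus o p ≡ map (p ⊕_) (rhombus o origin)
rhombus-at o p = trans (cong (rhombus o) (sym (⊕-identityʳ p))) (rhombus-⊕ o p origin)

-- By mate-⊕, the o-rhombus at the origin stands for the o-rhombus at any point of colour c.
MatesAcross : ℤ₄ → Orient → Orient → Pt → Set
MatesAcross c o o′ d = Any (λ u → mateOffset c u ∈ rhombus o′ d) (rhombus o origin)

matesAcross? : ∀ c o o′ d → Dec (MatesAcross c o o′ d)
matesAcross? c o o′ d = any? (λ u → mateOffset c u ∈? rhombus o′ d) (rhombus o origin)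

mates-across : ∀ {o o′ d} p → MatesAcross (colour p) o o′ d →
               ∃ λ x → x ∈ rhombus o p × mate x ∈ rhombus o′ (p ⊕ d)
mates-across {o} {o′} {d} p across with Mem.find across
... | u , u∈ , mate-u∈ =
  p ⊕ u ,
  subst (p ⊕ u ∈_) (sym (rhombus-at o p)) (∈-map⁺ (p ⊕_) u∈) ,
  subst₂ _∈_ (sym (mate-⊕ p u)) (sym (rhombus-⊕ o′ p d)) (∈-map⁺ (p ⊕_) mate-u∈)

Exceptional : Orient → ℤ₄ → Set
Exceptional o₁ c = c ≡ 2F
Exceptional o₂ c = c ≡ 1F
Exceptional o₃ c = ⊥

exceptional? : ∀ o c → Dec (Exceptional o c)
exceptional? o₁ c = c Fin.≟ 2F
exceptional? o₂ c = c Fin.≟ 1F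
exceptional? o₃ c = no λ ()

mates-or-exceptional : ∀ o c → MatesAcross c o o origin ⊎ Exceptional o c
mates-or-exceptional o₁ = from-yes (Fin.all? λ c → matesAcross? c o₁ o₁ origin ⊎-dec exceptional? o₁ c)
mates-or-exceptional o₂ = from-yes (Fin.all? λ c → matesAcross? c o₂ o₂ origin ⊎-dec exceptional? o₂ c)
mates-or-exceptional o₃ = from-yes (Fin.all? λ c → matesAcross? c o₃ o₃ origin ⊎-dec exceptional? o₃ c)

Missed : List Pt → List Pt → List Pt → Set
Missed V M W = All (λ w → w ∈ V × w ∉ M) W

keyOffset : Orient → Pt
keyOffset o₁ = origin
keyOffset o₂ = + 1 , -[1+ 1 ]
keyOffset o₃ = origin  -- never used: every o₃-rhombus contains a pair of mates

key : Orient × Pt → Pt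
key (o , p) = p ⊕ keyOffset o

colour-key : ∀ o p → Exceptional o (colour p) → colour (key (o , p)) ≡ 2F
colour-key o₁ p e = trans (colour-homo-⊕ p (keyOffset o₁)) (cong (_+₄ colour (keyOffset o₁)) e)
colour-key o₂ p e = trans (colour-homo-⊕ p (keyOffset o₂)) (cong (_+₄ colour (keyOffset o₂)) e)

module _ {V M : List Pt} (meets : MeetsMates V M) where

  missed-no-mates : ∀ {W W′ x} → Missed V M W → Missed V M W′ → x ∈ W → mate x ∈ W′ → ⊥
  missed-no-mates missed missed′ x∈W mate∈W′ with All.lookup missed x∈W | All.lookup missed′ mate∈W′
  ... | x∈V , x∉M | mate∈V , mate∉M = [ x∉M , mate∉M ]′ (meets x∈V mate∈V)

  missed-no-mates-across : ∀ {o o′ d} p → Missed V M (rhombus o p) → Missed V M (rhombus o′ (p ⊕ d)) →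
                           ¬ MatesAcross (colour p) o o′ d
  missed-no-mates-across p missed missed′ across =
    let x , x∈ , mate∈ = mates-across p across in missed-no-mates missed missed′ x∈ mate∈

  missed-exceptional : ∀ o p → Missed V M (rhombus o p) → Exceptional o (colour p)
  missed-exceptional o p missed =
    [ (λ within → ⊥-elim (missed-no-mates-across {o} {o} {origin} p missed missed′ within)) , id ]′
      (mates-or-exceptional o (colour p))
    where
    missed′ : Missed V M (rhombus o (p ⊕ origin))
    missed′ = subst (λ q → Missed V M (rhombus o q)) (sym (⊕-identityʳ p)) missed

  not-both-missed : ∀ {p p′} → colour p ≡ 2F → key (o₁ , p) ≡ key (o₂ , p′) →
                   Missed V M (rhombus o₁ p) → Missed V M (rhombus o₂ p′) → ⊥
  not-both-missed {p} {p′} c e missed missed′ =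
    missed-no-mates-across {o₁} {o₂} {d} p missed (subst (λ q → Missed V M (rhombus o₂ q)) p′≡ missed′)
      (subst (λ c → MatesAcross c o₁ o₂ d) (sym c) (from-yes (matesAcross? 2F o₁ o₂ d)))
    where
    d : Pt
    d = -[1+ 0 ] , + 2
    p′≡ : p′ ≡ p ⊕ d
    p′≡ = ⊕-cancelʳ (keyOffset o₂) (trans (sym e) (sym (⊕-assoc p d (keyOffset o₂))))

  missed-key-injective : ∀ {o p o′ p′} → Missed V M (rhombus o p) → Missed V M (rhombus o′ p′) →
                         key (o , p) ≡ key (o′ , p′) → (o , p) ≡ (o′ , p′)
  missed-key-injective {o₃} {p} missed _ _ = ⊥-elim (missed-exceptional o₃ p missed)
  missed-key-injective {o′ = o₃} {p′} _ missed′ _ = ⊥-elim (missed-exceptional o₃ p′ missed′)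
  missed-key-injective {o₁} {o′ = o₁} _ _ e = cong (o₁ ,_) (⊕-cancelʳ (keyOffset o₁) e)
  missed-key-injective {o₂} {o′ = o₂} _ _ e = cong (o₂ ,_) (⊕-cancelʳ (keyOffset o₂) e)
  missed-key-injective {o₁} {p} {o₂} missed missed′ e =
    ⊥-elim (not-both-missed (missed-exceptional o₁ p missed) e missed missed′)
  missed-key-injective {o₂} {o′ = o₁} {p′} missed missed′ e =
    ⊥-elim (not-both-missed (missed-exceptional o₁ p′ missed′) (sym e) missed′ missed)
-- Blocks of twelve rhombi

rh : Orient × Pt → List Pt
rh (o , p) = rhombus o p

deltas : List Pt
deltas = origin ∷ (+ 1 , + 0) ∷ (+ 0 , + 1) ∷ (-[1+ 0 ] , + 2) ∷ []

blockShape : List (Orient × Pt)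
blockShape = cartesianProduct orients deltas

blockPoints : List Pt
blockPoints = concatMap rh blockShape

BlockIn : List Pt → Pt → Set
BlockIn V k = All (λ d → k ⊕ d ∈ V) blockPoints

blockIn? : ∀ V → Decidable (BlockIn V)
blockIn? V k = all? (λ d → k ⊕ d ∈? V) blockPoints

blockOffset : ℤ₄ → Pt
blockOffset 2F = origin
blockOffset 3F = + 1 , + 0
blockOffset 0F = + 0 , + 1
blockOffset 1F = -[1+ 0 ] , + 2

blockOffset-colour : All (λ δ → blockOffset (2F +₄ colour δ) ≡ δ) deltas
blockOffset-colour = from-yes (all? (λ δ → blockOffset (2F +₄ colour δ) ≟P δ) deltas)

box : List Pt
box = cartesianProduct (range 4) (range 4)

Close : Pt → Set
Close off = T (dist off origin ≤ᵇ 4) × off ∈ box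

close? : Decidable Close
close? off = Bool.T? (dist off origin ≤ᵇ 4) ×-dec (off ∈? box)

block-close : ∀ o → All (λ d → Close (keyOffset o ⊕ d)) blockPoints
block-close o₁ = from-yes (all? (λ d → close? (keyOffset o₁ ⊕ d)) blockPoints)
block-close o₂ = from-yes (all? (λ d → close? (keyOffset o₂ ⊕ d)) blockPoints)
block-close o₃ = from-yes (all? (λ d → close? (keyOffset o₃ ⊕ d)) blockPoints)

dist-⊕ : ∀ p q r → dist (p ⊕ q) (p ⊕ r) ≡ dist q r
dist-⊕ (a , b) (c , d) (e , f) = cong₂ (λ x y → ∣ x ∣ ⊔ ∣ y ∣ ⊔ ∣ x ℤ.+ y ∣) (cancel a c e) (cancel b d f)
  where
  cancel : ∀ a c e → (a ℤ.+ c) ℤ.- (a ℤ.+ e) ≡ c ℤ.- e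
  cancel = ℤ-Solver.solve-∀

dist-from : ∀ p q → dist (p ⊕ q) p ≡ dist q origin
dist-from p q = trans (cong (dist (p ⊕ q)) (sym (⊕-identityʳ p))) (dist-⊕ p q origin)

near-witness : ∀ {V W w off} → w ∈ W → Close off → w ⊕ off ∉ V → T (nearB 4 V W)
near-witness {V} {W} {w} {off} w∈W (close , off∈box) outside =
  Anyₚ.any⁺ (λ w → any (probe w) box)
    (Any.map (λ { refl → Anyₚ.any⁺ (probe w) (Mem.lose off∈box hit) }) w∈W)
  where
  probe : Pt → Pt → Bool
  probe w off = (dist (w ⊕ off) w ≤ᵇ 4) ∧ not (does (w ⊕ off ∈? V))
  hit : T (probe w off)
  hit = Equivalence.from Bool.T-∧
          ( subst (λ n → T (n ≤ᵇ 4)) (sym (dist-from w off)) close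
          , Equivalence.from Bool.T-not-≡ (dec-false (w ⊕ off ∈? V) outside))

anchor∈ : ∀ o p → p ∈ rhombus o p
anchor∈ o₁ p = here refl
anchor∈ o₂ p = here refl
anchor∈ o₃ p = here refl

block-out⇒near : ∀ {V} o p → ¬ BlockIn V (key (o , p)) → T (nearB 4 V (rhombus o p))
block-out⇒near {V} o p out =
  let d , d∈ , outside = Mem.find (Allₚ.¬All⇒Any¬ (λ d → key (o , p) ⊕ d ∈? V) blockPoints out)
  in near-witness (anchor∈ o p) (All.lookup (block-close o) d∈)
                  (λ inside → outside (subst (_∈ V) (sym (⊕-assoc p (keyOffset o) d)) inside))

inside? : ∀ V → Decidable (λ x → All (_∈ V) (rh x))
inside? V x = all? (_∈? V) (rh x)

rhombi : List Pt → List (Orient × Pt)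
rhombi V = filter (inside? V) (cartesianProduct orients V)

∈-orients : ∀ o → o Mem.∈ orients
∈-orients o₁ = here refl
∈-orients o₂ = there (here refl)
∈-orients o₃ = there (there (here refl))

∈-rhombi⁺ : ∀ {V} o {p} → All (_∈ V) (rhombus o p) → (o , p) Mem.∈ rhombi V
∈-rhombi⁺ {V} o {p} inV =
  ∈-filter⁺ (inside? V) (∈-cartesianProduct⁺ (∈-orients o) (All.lookup inV (anchor∈ o p))) inV

∈-rhombi⁻ : ∀ {V x} → x Mem.∈ rhombi V → All (_∈ V) (rh x)
∈-rhombi⁻ {V} = proj₂ ∘ ∈-filter⁻ (inside? V) {xs = cartesianProduct orients V}

orients-unique : Unique orients
orients-unique = ((λ ()) ∷ (λ ()) ∷ []) ∷ ((λ ()) ∷ []) ∷ [] ∷ []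

deltas-unique : Unique deltas
deltas-unique = ((λ ()) ∷ (λ ()) ∷ (λ ()) ∷ []) ∷ ((λ ()) ∷ (λ ()) ∷ []) ∷ ((λ ()) ∷ []) ∷ [] ∷ []

rhombi-unique : ∀ {V} → Unique V → Unique (rhombi V)
rhombi-unique uV = Unique.filter⁺ (inside? _) (Unique.cartesianProduct⁺ orients-unique uV)

keys : List Pt → List Pt
keys V = filter (λ k → (colour k Fin.≟ 2F) ×-dec blockIn? V k) V

key∈keys : ∀ {V k} → colour k ≡ 2F → BlockIn V k → k ∈ keys V
key∈keys {V} {k} c block = ∈-filter⁺ _ (subst (_∈ V) (⊕-identityʳ k) (All.head block)) (c , block)

twelve-keys≤n : ∀ {V} → Unique V → 12 * length (keys V) ≤ length (winningSets V)
twelve-keys≤n {V} uV = begin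
  12 * length (keys V)                           ≡⟨ ℕ.*-comm 12 (length (keys V)) ⟩
  length (keys V) * length blockShape            ≡⟨ length-cartesianProduct (keys V) blockShape ⟨
  length (cartesianProduct (keys V) blockShape)  ≤⟨ length-≤-injection place unique into injective ⟩
  length (rhombi V)                              ≡⟨ List.length-map rh (rhombi V) ⟨
  length (winningSets V)                         ∎
  where
  open ℕ.≤-Reasoning
  place : Pt × (Orient × Pt) → Orient × Pt
  place (k , (o , δ)) = o , k ⊕ δ
  unique : Unique (cartesianProduct (keys V) blockShape)
  unique = Unique.cartesianProduct⁺ (Unique.filter⁺ _ uV) (Unique.cartesianProduct⁺ orients-unique deltas-unique)
  in-keys : ∀ {k} → k Mem.∈ keys V → colour k ≡ 2F × BlockIn V k
  in-keys = proj₂ ∘ ∈-filter⁻ _ {xs = V}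
  into : ∀ {x} → x Mem.∈ cartesianProduct (keys V) blockShape → place x Mem.∈ rhombi V
  into {k , (o , δ)} x∈ =
    let k∈ , oδ∈ = ∈-cartesianProduct⁻ (keys V) blockShape x∈
        block = proj₂ (in-keys k∈)
    in ∈-rhombi⁺ o (subst (All (_∈ V)) (sym (rhombus-⊕ o k δ))
         (Allₚ.map⁺ (All.tabulate λ d∈ → All.lookup block (∈-concatMap⁺ rh (Mem.lose oδ∈ d∈)))))
  in-product : ∀ {k o δ} → (k , (o , δ)) Mem.∈ cartesianProduct (keys V) blockShape →
               k Mem.∈ keys V × δ Mem.∈ deltas
  in-product x∈ = let k∈ , oδ∈ = ∈-cartesianProduct⁻ (keys V) blockShape x∈
                  in k∈ , proj₂ (∈-cartesianProduct⁻ orients deltas oδ∈)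
  offset-recovered : ∀ {k δ} → k Mem.∈ keys V × δ Mem.∈ deltas → blockOffset (colour (k ⊕ δ)) ≡ δ
  offset-recovered {k} {δ} (k∈ , δ∈) =
    trans (cong blockOffset (trans (colour-homo-⊕ k δ) (cong (_+₄ colour δ) (proj₁ (in-keys k∈)))))
          (All.lookup blockOffset-colour δ∈)
  injective : ∀ {x y} → x Mem.∈ cartesianProduct (keys V) blockShape →
              y Mem.∈ cartesianProduct (keys V) blockShape → place x ≡ place y → x ≡ y
  injective {k , (o , δ)} {k′ , (o′ , δ′)} x∈ y∈ e = cong₂ _,_ k≡k′ (cong₂ _,_ (cong proj₁ e) δ≡δ′)
    where
    δ≡δ′ : δ ≡ δ′
    δ≡δ′ = trans (sym (offset-recovered (in-product x∈)))
                 (trans (cong (blockOffset ∘ colour ∘ proj₂) e) (offset-recovered (in-product y∈)))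
    k≡k′ : k ≡ k′
    k≡k′ = ⊕-cancelʳ δ (trans (cong proj₂ e) (cong (k′ ⊕_) (sym δ≡δ′)))

-- Counting the rhombi Maker misses

module _ {V M : List Pt} (uV : Unique V) (meets : MeetsMates V M) where

  Scored Near Far : Orient × Pt → Set
  Scored x = 1 ≤ claimedIn M (rh x)
  Near   x = T (nearB 4 V (rh x))
  Far    x = ¬ Scored x × BlockIn V (key x)

  scored? : Decidable Scored
  scored? x = 1 ℕ.≤? claimedIn M (rh x)

  near? : Decidable Near
  near? x = Bool.T? (nearB 4 V (rh x))

  far? : Decidable Far
  far? x = ¬? (scored? x) ×-dec blockIn? V (key x)

  classify : ∀ {x} → x Mem.∈ rhombi V → Scored x ⊎ Near x ⊎ Far x
  classify {o , p} _ with scored? (o , p) | blockIn? V (key (o , p))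
  ... | yes scored  | _          = inj₁ scored
  ... | no unscored | yes inside = inj₂ (inj₂ (unscored , inside))
  ... | no _        | no out     = inj₂ (inj₁ (block-out⇒near o p out))

  missed : ∀ {x} → x Mem.∈ rhombi V → ¬ Scored x → Missed V M (rh x)
  missed {x} x∈ unscored = All.tabulate λ {w} w∈ →
    All.lookup (∈-rhombi⁻ x∈) w∈ , λ w∈M → unscored (List.filter-some (_∈? M) (Any.map (λ { refl → w∈M }) w∈))

  far≤keys : length (filter far? (rhombi V)) ≤ length (keys V)
  far≤keys = length-≤-injection key (Unique.filter⁺ far? (rhombi-unique uV)) into injective
    where
    in-far : ∀ {x} → x Mem.∈ filter far? (rhombi V) → Missed V M (rh x) × BlockIn V (key x)
    in-far x∈ = let x∈rhombi , unscored , block = ∈-filter⁻ far? {xs = rhombi V} x∈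
                in missed x∈rhombi unscored , block
    into : ∀ {x} → x Mem.∈ filter far? (rhombi V) → key x ∈ keys V
    into {o , p} x∈ = let m , block = in-far x∈
                      in key∈keys (colour-key o p (missed-exceptional meets o p m)) block
    injective : ∀ {x y} → x Mem.∈ filter far? (rhombi V) → y Mem.∈ filter far? (rhombi V) →
                key x ≡ key y → x ≡ y
    injective x∈ y∈ = missed-key-injective meets (proj₁ (in-far x∈)) (proj₁ (in-far y∈))

  rhombi-bound : length (winningSets V) ≤
                 score V 1 M + length (filterᵇ (nearB 4 V) (winningSets V)) + length (keys V)
  rhombi-bound = begin
    length (winningSets V)
      ≡⟨ List.length-map rh (rhombi V) ⟩
    length (rhombi V)
      ≡⟨ cong length (List.filter-all (scored? ∪? (near? ∪? far?)) (All.tabulate classify)) ⟨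
    length (filter (scored? ∪? (near? ∪? far?)) (rhombi V))
      ≤⟨ length-filter-∪ scored? (near? ∪? far?) (rhombi V) ⟩
    #scored + length (filter (near? ∪? far?) (rhombi V))
      ≤⟨ ℕ.+-monoʳ-≤ #scored (length-filter-∪ near? far? (rhombi V)) ⟩
    #scored + (#near + length (filter far? (rhombi V)))
      ≤⟨ ℕ.+-monoʳ-≤ #scored (ℕ.+-monoʳ-≤ #near far≤keys) ⟩
    #scored + (#near + length (keys V))
      ≡⟨ ℕ.+-assoc #scored #near (length (keys V)) ⟨
    #scored + #near + length (keys V)
      ≡⟨ cong₂ (λ a b → a + b + length (keys V))
               (length-filter-map rh (λ W → 1 ℕ.≤? claimedIn M W) (rhombi V))
               (length-filter-map rh (Bool.T? ∘ nearB 4 V) (rhombi V)) ⟨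
    score V 1 M + length (filterᵇ (nearB 4 V) (winningSets V)) + length (keys V)
      ∎
    where
    open ℕ.≤-Reasoning
    #scored #near : ℕ
    #scored = length (filter scored? (rhombi V))
    #near   = length (filter near? (rhombi V))

pairing-score : (G : Grid) →
                ∃ λ f → 12 * f ≤ nWin G × PairingGuarantees (pts G) 1 (nWin G ∸ (nearCount 4 G + f))
pairing-score G = length (keys V) , twelve-keys≤n (uniq G) , matePairs V , isPairing ,
                  PairingStrategy.pairingStrategy isPairing enough
  where
  V : List Pt
  V = pts G
  isPairing : IsPairing V (matePairs V)
  isPairing = matePairs-isPairing (uniq G)
  enough : ∀ M → Meets (matePairs V) M → nWin G ∸ (nearCount 4 G + length (keys V)) ≤ score V 1 M
  enough M meets = ℕ.m≤n+o⇒m∸n≤o (nWin G) (nearCount 4 G + length (keys V))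
    (ℕ.≤-trans (rhombi-bound (uniq G) (meets-mates meets)) (ℕ.≤-reflexive (regroup (score V 1 M) _ _)))
    where
    regroup : ∀ s b f → s + b + f ≡ b + f + s
    regroup = solve-∀

eleven-twelfths : ∀ k n b f → 12 * f ≤ n → 12 * k * b ≤ n → 11 * k * n ≤ 12 * k * (n ∸ (b + f)) + n
eleven-twelfths k n b f few-far few-near = ℕ.+-cancelʳ-≤ (k * n) (11 * k * n) (12 * k * t + n) (begin
  11 * k * n + k * n                      ≡⟨ e₁ k n ⟩
  12 * k * n                              ≤⟨ ℕ.*-monoʳ-≤ (12 * k) (ℕ.m≤n+m∸n n (b + f)) ⟩
  12 * k * (b + f + t)                    ≡⟨ e₂ k b f t ⟩
  12 * k * b + k * (12 * f) + 12 * k * t  ≤⟨ ℕ.+-monoˡ-≤ _ (ℕ.+-mono-≤ few-near (ℕ.*-monoʳ-≤ k few-far)) ⟩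
  n + k * n + 12 * k * t                  ≡⟨ e₃ k n t ⟩
  12 * k * t + n + k * n                  ∎)
  where
  open ℕ.≤-Reasoning
  t : ℕ
  t = n ∸ (b + f)
  e₁ : ∀ k n → 11 * k * n + k * n ≡ 12 * k * n
  e₁ = solve-∀
  e₂ : ∀ k b f t → 12 * k * (b + f + t) ≡ 12 * k * b + k * (12 * f) + 12 * k * t
  e₂ = solve-∀
  e₃ : ∀ k n t → n + k * n + 12 * k * t ≡ 12 * k * t + n + k * n
  e₃ = solve-∀

theorem14 :
    (G : ℕ → Grid) →
    -- n → ∞ along the family
    (∀ N → ∃ λ M → ∀ m → M ≤ m → N ≤ nWin (G m)) →
    -- two-dimensional: for every constant c, #(sets within distance c of boundary) = o(n)
    (∀ c k → ∃ λ M → ∀ m → M ≤ m → k * nearCount c (G m) ≤ nWin (G m)) →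
    -- SC₂(G_◇,1) ≥ 11n/12 − o(n): for every k, eventually SC₂ ≥ 11n/12 − n/(12k)
    ∀ k → ∃ λ M → ∀ m → M ≤ m →
      ∃ λ t → PairingGuarantees (pts (G m)) 1 t
            × 11 * k * nWin (G m) ≤ 12 * k * t + nWin (G m)
-- The bound holds for every single grid.
theorem14 G _ two-dimensional k = M₀ , λ m M₀≤m →
  let f , few-far , guarantee = pairing-score (G m)
  in _ , guarantee , eleven-twelfths k (nWin (G m)) (nearCount 4 (G m)) f few-far (few-near m M₀≤m)
  where
  M₀ : ℕ
  M₀ = proj₁ (two-dimensional 4 (12 * k))
  few-near : ∀ m → M₀ ≤ m → 12 * k * nearCount 4 (G m) ≤ nWin (G m)
  few-near = proj₂ (two-dimensional 4 (12 * k))
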